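{- For any $s\in\sigma$ and $r\in\rho$, there is a $\{\sigma_s,\rho_r\}$-provider (with a single portal).
   Context: $\sigma,\rho$ are finite or cofinite subsets of $\mathbb{Z}_{\ge0}$. For a graph $G$ and a set of portals $U\subseteq V(G)$, a partial solution is $S\subseteq V(G)$ such that $|N(v)\cap S|\in\rho$ for all $v\in V(G)\setminus(S\cup U)$ and $|N(v)\cap S|\in\sigma$ for all $v\in S\setminus U$. A string $x$ over symbols $\{\sigma_i,\rho_i:i\ge0\}$ indexed by $U$ is compatible with $(G,U)$ if some partial solution $S$ satisfies, for each $v\in U$, $x[v]=\sigma_{|N(v)\cap S|}$ if $v\in S$ and $x[v]=\rho_{|N(v)\cap S|}$ if $v\notin S$. $(G,U)$ is an $L$-provider if every string of $L$ is compatible with $(G,U)$. -}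

module Defs where

open import Data.Nat using (ℕ; _<_; _≤_)
open import Data.Bool using (Bool; true; false)
open import Data.Fin using (Fin)
open import Data.Fin.Subset using (Subset; _∈_; _∉_; _∩_; ∣_∣; ⁅_⁆)
open import Data.Vec using (tabulate)
open import Data.Product using (Σ; ∃; _×_; proj₁)
open import Data.Sum using (_⊎_)
open import Data.Empty using (⊥)
open import Relation.Binary.PropositionalEquality using (_≡_)
open import Relation.Nullary using (¬_)

NatSet : Set₁
NatSet = ℕ → Set

Finite : NatSet → Set
Finite A = ∃ λ N → ∀ m → A m → m < N

Cofinite : NatSet → Set
Cofinite A = ∃ λ N → ∀ m → N ≤ m → A m

FinOrCofinite : NatSet → Set
FinOrCofinite A = Finite A ⊎ Cofinite A

record Graph : Set where
  field
    n     : ℕ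
    adj   : Fin n → Fin n → Bool
    sym   : ∀ u v → adj u v ≡ adj v u
    irr   : ∀ v → adj v v ≡ false

open Graph public

N : (G : Graph) → Fin (n G) → Subset (n G)
N G v = tabulate (adj G v)

degIn : (G : Graph) → Subset (n G) → Fin (n G) → ℕ
degIn G S v = ∣ N G v ∩ S ∣

PartialSolution : NatSet → NatSet → (G : Graph) → Subset (n G) → Subset (n G) → Set
PartialSolution σ ρ G U S =
  (∀ v → v ∉ S → v ∉ U → ρ (degIn G S v)) ×
  (∀ v → v ∈ S → v ∉ U → σ (degIn G S v))

data Symbol : Set where
  σ-sym : ℕ → Symbol
  ρ-sym : ℕ → Symbol

Portal : (G : Graph) → Subset (n G) → Set
Portal G U = Σ (Fin (n G)) (λ v → v ∈ U)

PortalString : (G : Graph) → Subset (n G) → Set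
PortalString G U = Portal G U → Symbol

StateIs : (G : Graph) → Subset (n G) → Fin (n G) → Symbol → Set
StateIs G S v x =
  (v ∈ S × x ≡ σ-sym (degIn G S v)) ⊎ (v ∉ S × x ≡ ρ-sym (degIn G S v))

Compatible : NatSet → NatSet → (G : Graph) → (U : Subset (n G)) → PortalString G U → Set
Compatible σ ρ G U x =
  ∃ λ S → PartialSolution σ ρ G U S × (∀ (p : Portal G U) → StateIs G S (proj₁ p) (x p))

Provider : NatSet → NatSet → (G : Graph) → (U : Subset (n G)) → (PortalString G U → Set) → Set
Provider σ ρ G U L = ∀ x → L x → Compatible σ ρ G U x

Lang-σs-ρr : ℕ → ℕ → (G : Graph) → (U : Subset (n G)) → PortalString G U → Set
Lang-σs-ρr s r G U x = (∀ p → x p ≡ σ-sym s) ⊎ (∀ p → x p ≡ ρ-sym r)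

{-# OPTIONS --safe #-}

-- Take two layers b ∈ {0, 1}, each consisting of r + 1 disjoint cliques K_{s+1} (rows p, positions a),
-- and join (b , p , a) to (1 - b , p′ , a) whenever p ≠ p′. Every vertex then has exactly s neighbours
-- in its own layer and r in the other, so choosing either layer as S puts every vertex in state σ_s
-- (inside S) or ρ_r (outside S). A portal in layer 0 therefore realises σ_s with S = layer 0 and
-- ρ_r with S = layer 1.
module Submission where

open import Defs hiding (sym)
open import Data.Nat using (ℕ; zero; suc; _+_; _*_)
open import Data.Nat.Properties
  using (+-*-semiring; +-assoc; +-identityʳ; *-identityˡ; *-identityʳ; *-zeroʳ)
open import Data.Fin using (Fin; zero; suc; _↑ˡ_; _↑ʳ_; combine; remQuot)
open import Data.Fin.Properties using (remQuot-combine)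
open import Data.Fin.Subset using (Subset; _∈_; _∉_; _∩_; ∣_∣; ⁅_⁆)
open import Data.Fin.Subset.Properties using (x∈⁅y⁆⇒x≡y)
open import Data.Vec using (tabulate)
open import Data.Vec.Properties using (lookup∘tabulate; lookup⇒[]=; []=⇒lookup)
open import Data.Bool using (Bool; true; false; _∧_; not; if_then_else_)
open import Data.Product using (Σ; ∃; _×_; _,_; proj₁; map₂)
open import Data.Sum using (inj₁; inj₂)
open import Data.Empty using (⊥-elim)
open import Function using (_∘′_)
open import Relation.Binary.PropositionalEquality
  using (_≡_; refl; sym; trans; cong; cong₂; subst; module ≡-Reasoning)
open import Algebra.Properties.Semiring.Sum +-*-semiring
  using (sum; sum-syntax; sum-cong-≗; sum-replicate-zero; *-distribˡ-sum; *-distribʳ-sum)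

open ≡-Reasoning

𝟙 : Bool → ℕ
𝟙 true  = 1
𝟙 false = 0

𝟙-∧ : ∀ x y → 𝟙 (x ∧ y) ≡ 𝟙 x * 𝟙 y
𝟙-∧ true  y = sym (+-identityʳ (𝟙 y))
𝟙-∧ false y = refl

∑-one : ∀ n → ∑[ i < n ] 1 ≡ n
∑-one zero    = refl
∑-one (suc n) = cong suc (∑-one n)

∑-splitAt : ∀ m {k} (f : Fin (m + k) → ℕ) →
  ∑[ i < m + k ] f i ≡ ∑[ i < m ] f (i ↑ˡ k) + ∑[ j < k ] f (m ↑ʳ j)
∑-splitAt zero    f = refl
∑-splitAt (suc m) f =
  trans (cong (f zero +_) (∑-splitAt m (λ i → f (suc i)))) (sym (+-assoc (f zero) _ _))

∑-combine : ∀ m {k} (f : Fin (m * k) → ℕ) →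
  ∑[ w < m * k ] f w ≡ ∑[ i < m ] ∑[ j < k ] f (combine i j)
∑-combine zero    f = refl
∑-combine (suc m) {k} f =
  trans (∑-splitAt k f) (cong (∑[ j < k ] f (j ↑ˡ (m * k)) +_) (∑-combine m (λ w → f (k ↑ʳ w))))

∑-product : ∀ {m k} (f : Fin m → ℕ) (g : Fin k → ℕ) →
  ∑[ i < m ] ∑[ j < k ] (f i * g j) ≡ (∑[ i < m ] f i) * (∑[ j < k ] g j)
∑-product {k = k} f g = begin
  ∑[ i < _ ] ∑[ j < k ] (f i * g j)  ≡⟨ sum-cong-≗ (λ i → sym (*-distribˡ-sum (f i) g)) ⟩
  ∑[ i < _ ] (f i * sum g)           ≡⟨ sym (*-distribʳ-sum (sum g) f) ⟩
  sum f * sum g                      ∎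

∑-𝟙-∧ : ∀ {m k} (f : Fin m → Bool) (g : Fin k → Bool) →
  ∑[ i < m ] ∑[ j < k ] 𝟙 (f i ∧ g j) ≡ (∑[ i < m ] 𝟙 (f i)) * (∑[ j < k ] 𝟙 (g j))
∑-𝟙-∧ f g =
  trans (sum-cong-≗ (λ i → sum-cong-≗ (λ j → 𝟙-∧ (f i) (g j)))) (∑-product (𝟙 ∘′ f) (𝟙 ∘′ g))

∑∑-𝟙-∧ʳ : ∀ {m k} (f : Fin m → Fin k → Bool) (β : Bool) →
  ∑[ i < m ] ∑[ j < k ] 𝟙 (f i j ∧ β) ≡ (∑[ i < m ] ∑[ j < k ] 𝟙 (f i j)) * 𝟙 β
∑∑-𝟙-∧ʳ {m} {k} f β = begin
  ∑[ i < m ] ∑[ j < k ] 𝟙 (f i j ∧ β)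
    ≡⟨ sum-cong-≗ (λ i → sum-cong-≗ (λ j → 𝟙-∧ (f i j) β)) ⟩
  ∑[ i < m ] ∑[ j < k ] (𝟙 (f i j) * 𝟙 β)
    ≡⟨ sum-cong-≗ (λ i → sym (*-distribʳ-sum (𝟙 β) (λ j → 𝟙 (f i j)))) ⟩
  ∑[ i < m ] (∑[ j < k ] 𝟙 (f i j) * 𝟙 β)
    ≡⟨ sym (*-distribʳ-sum (𝟙 β) (λ i → ∑[ j < k ] 𝟙 (f i j))) ⟩
  (∑[ i < m ] ∑[ j < k ] 𝟙 (f i j)) * 𝟙 β
    ∎

infix 7 _≡ᵇ_

_≡ᵇ_ : ∀ {n} → Fin n → Fin n → Bool
zero  ≡ᵇ zero  = true
zero  ≡ᵇ suc _ = false
suc _ ≡ᵇ zero  = false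
suc i ≡ᵇ suc j = i ≡ᵇ j

≡ᵇ-refl : ∀ {n} (i : Fin n) → (i ≡ᵇ i) ≡ true
≡ᵇ-refl zero    = refl
≡ᵇ-refl (suc i) = ≡ᵇ-refl i

≡ᵇ-sym : ∀ {n} (i j : Fin n) → (i ≡ᵇ j) ≡ (j ≡ᵇ i)
≡ᵇ-sym zero    zero    = refl
≡ᵇ-sym zero    (suc j) = refl
≡ᵇ-sym (suc i) zero    = refl
≡ᵇ-sym (suc i) (suc j) = ≡ᵇ-sym i j

∑-select : ∀ {n} (f : Fin n → ℕ) (i : Fin n) → ∑[ j < n ] (f j * 𝟙 (j ≡ᵇ i)) ≡ f i
∑-select {suc n} f zero =
  trans (cong₂ _+_ (*-identityʳ (f zero)) ∑-others) (+-identityʳ (f zero))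
  where
  ∑-others : ∑[ j < n ] (f (suc j) * 0) ≡ 0
  ∑-others = trans (sum-cong-≗ (λ j → *-zeroʳ (f (suc j)))) (sum-replicate-zero n)
∑-select {suc n} f (suc i) = cong₂ _+_ (*-zeroʳ (f zero)) (∑-select (λ j → f (suc j)) i)

∑-𝟙-≡ᵇ : ∀ {n} (i : Fin n) → ∑[ j < n ] 𝟙 (i ≡ᵇ j) ≡ 1
∑-𝟙-≡ᵇ {suc n} zero    = cong suc (sum-replicate-zero n)
∑-𝟙-≡ᵇ {suc n} (suc i) = ∑-𝟙-≡ᵇ i

∑-𝟙-≢ᵇ : ∀ {n} (i : Fin (suc n)) → ∑[ j < suc n ] 𝟙 (not (i ≡ᵇ j)) ≡ n
∑-𝟙-≢ᵇ {n}     zero    = ∑-one n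
∑-𝟙-≢ᵇ {suc n} (suc i) = cong suc (∑-𝟙-≢ᵇ i)

∣tabulate∩tabulate∣ : ∀ {n} (f g : Fin n → Bool) →
  ∣ tabulate f ∩ tabulate g ∣ ≡ ∑[ i < n ] 𝟙 (f i ∧ g i)
∣tabulate∩tabulate∣ {zero}  f g = refl
∣tabulate∩tabulate∣ {suc n} f g with f zero ∧ g zero
... | true  = cong suc (∣tabulate∩tabulate∣ (f ∘′ suc) (g ∘′ suc))
... | false = ∣tabulate∩tabulate∣ (f ∘′ suc) (g ∘′ suc)

∈-tabulate⁺ : ∀ {n} (f : Fin n → Bool) {i} → f i ≡ true → i ∈ tabulate f
∈-tabulate⁺ f {i} fi≡true = lookup⇒[]= i (tabulate f) (trans (lookup∘tabulate f i) fi≡true)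

∈-tabulate⁻ : ∀ {n} (f : Fin n → Bool) {i} → i ∈ tabulate f → f i ≡ true
∈-tabulate⁻ f {i} i∈ = trans (sym (lookup∘tabulate f i)) ([]=⇒lookup i∈)

record ExactDegrees (s r : ℕ) (G : Graph) (S : Subset (n G)) : Set where
  field
    degree-∈ : ∀ v → v ∈ S → degIn G S v ≡ s
    degree-∉ : ∀ v → v ∉ S → degIn G S v ≡ r

open ExactDegrees

module _ {G : Graph} {S : Subset (n G)} where

  stateIs-∈ : ∀ {s r v} → ExactDegrees s r G S → v ∈ S → StateIs G S v (σ-sym s)
  stateIs-∈ exact v∈S = inj₁ (v∈S , cong σ-sym (sym (degree-∈ exact _ v∈S)))

  stateIs-∉ : ∀ {s r v} → ExactDegrees s r G S → v ∉ S → StateIs G S v (ρ-sym r)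
  stateIs-∉ exact v∉S = inj₂ (v∉S , cong ρ-sym (sym (degree-∉ exact _ v∉S)))

  stateIs-⁅⁆ : ∀ {u y} → StateIs G S u y → (x : PortalString G ⁅ u ⁆) → (∀ p → x p ≡ y) →
    ∀ p → StateIs G S (proj₁ p) (x p)
  stateIs-⁅⁆ {u} st x x≡y (v , v∈⁅u⁆) rewrite x≡y (v , v∈⁅u⁆) | x∈⁅y⁆⇒x≡y u v∈⁅u⁆ = st

module _ {σ ρ : NatSet} {s r : ℕ} (σs : σ s) (ρr : ρ r) {G : Graph} where

  exact⇒partialSolution : ∀ {S} U → ExactDegrees s r G S → PartialSolution σ ρ G U S
  exact⇒partialSolution U exact =
    (λ v v∉S _ → subst ρ (sym (degree-∉ exact v v∉S)) ρr) ,
    (λ v v∈S _ → subst σ (sym (degree-∈ exact v v∈S)) σs)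

  exact⇒provider : ∀ {S₁ S₂ u} → ExactDegrees s r G S₁ → ExactDegrees s r G S₂ →
    u ∈ S₁ → u ∉ S₂ → Provider σ ρ G ⁅ u ⁆ (Lang-σs-ρr s r G ⁅ u ⁆)
  exact⇒provider {S₁} {u = u} exact₁ _ u∈S₁ _ x (inj₁ x≡σₛ) =
    S₁ , exact⇒partialSolution ⁅ u ⁆ exact₁ , stateIs-⁅⁆ {G} {S₁} (stateIs-∈ exact₁ u∈S₁) x x≡σₛ
  exact⇒provider {S₂ = S₂} {u} _ exact₂ _ u∉S₂ x (inj₂ x≡ρᵣ) =
    S₂ , exact⇒partialSolution ⁅ u ⁆ exact₂ , stateIs-⁅⁆ {G} {S₂} (stateIs-∉ exact₂ u∉S₂) x x≡ρᵣ

module Gadget (r s : ℕ) where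

  Vertex : Set
  Vertex = Fin 2 × Fin (suc r) × Fin (suc s)

  adjacent : Vertex → Vertex → Bool
  adjacent (b , p , a) (b′ , p′ , a′) =
    if b ≡ᵇ b′ then p ≡ᵇ p′ ∧ not (a ≡ᵇ a′) else not (p ≡ᵇ p′) ∧ a ≡ᵇ a′

  adjacent-irrefl : ∀ t → adjacent t t ≡ false
  adjacent-irrefl (b , p , a) rewrite ≡ᵇ-refl b | ≡ᵇ-refl p | ≡ᵇ-refl a = refl

  adjacent-sym : ∀ t t′ → adjacent t t′ ≡ adjacent t′ t
  adjacent-sym (b , p , a) (b′ , p′ , a′)
    rewrite ≡ᵇ-sym b b′ | ≡ᵇ-sym p p′ | ≡ᵇ-sym a a′ = refl

  order : ℕ
  order = 2 * (suc r * suc s)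

  encode : Vertex → Fin order
  encode (b , p , a) = combine b (combine p a)

  decode : Fin order → Vertex
  decode w = map₂ (remQuot (suc s)) (remQuot (suc r * suc s) w)

  decode-encode : ∀ t → decode (encode t) ≡ t
  decode-encode (b , p , a) = begin
    map₂ (remQuot (suc s)) (remQuot (suc r * suc s) (combine b (combine p a)))
      ≡⟨ cong (map₂ (remQuot (suc s))) (remQuot-combine b (combine p a)) ⟩
    b , remQuot (suc s) (combine p a)
      ≡⟨ cong (b ,_) (remQuot-combine p a) ⟩
    b , p , a ∎

  graph : Graph
  graph = record
    { n   = order
    ; adj = λ v w → adjacent (decode v) (decode w)
    ; sym = λ v w → adjacent-sym (decode v) (decode w)
    ; irr = λ v → adjacent-irrefl (decode v)
    }

  colour : Fin order → Fin 2
  colour w = proj₁ (decode w)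

  layer : Fin 2 → Subset order
  layer c = tabulate (λ w → colour w ≡ᵇ c)

  ∑-vertices : (F : Vertex → ℕ) →
    ∑[ w < order ] F (decode w) ≡ ∑[ b < 2 ] ∑[ p < suc r ] ∑[ a < suc s ] F (b , p , a)
  ∑-vertices F =
    trans (∑-combine 2 {suc r * suc s} (F ∘′ decode)) (sum-cong-≗ {2} λ b →
    trans (∑-combine (suc r) {suc s} (λ q → F (decode (combine b q))))
          (sum-cong-≗ {suc r} λ p → sum-cong-≗ {suc s} λ a → cong F (decode-encode (b , p , a))))

  neighbours-in-layer : ∀ t c →
    ∑[ p < suc r ] ∑[ a < suc s ] 𝟙 (adjacent t (c , p , a)) ≡ (if proj₁ t ≡ᵇ c then s else r)
  neighbours-in-layer (b , p , a) c with b ≡ᵇ c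
  ... | true  = trans (∑-𝟙-∧ (p ≡ᵇ_) (λ a′ → not (a ≡ᵇ a′)))
                  (trans (cong₂ _*_ (∑-𝟙-≡ᵇ p) (∑-𝟙-≢ᵇ a)) (*-identityˡ s))
  ... | false = trans (∑-𝟙-∧ (λ p′ → not (p ≡ᵇ p′)) (a ≡ᵇ_))
                  (trans (cong₂ _*_ (∑-𝟙-≢ᵇ p) (∑-𝟙-≡ᵇ a)) (*-identityʳ r))

  degree-layer : ∀ c v → degIn graph (layer c) v ≡ (if colour v ≡ᵇ c then s else r)
  degree-layer c v = begin
    degIn graph (layer c) v
      ≡⟨ ∣tabulate∩tabulate∣ (λ w → adjacent t (decode w)) (λ w → colour w ≡ᵇ c) ⟩
    ∑[ w < order ] 𝟙 (adjacent t (decode w) ∧ colour w ≡ᵇ c)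
      ≡⟨ ∑-vertices (λ t′ → 𝟙 (adjacent t t′ ∧ proj₁ t′ ≡ᵇ c)) ⟩
    ∑[ b < 2 ] ∑[ p < suc r ] ∑[ a < suc s ] 𝟙 (adjacent t (b , p , a) ∧ b ≡ᵇ c)
      ≡⟨ sum-cong-≗ (λ b → ∑∑-𝟙-∧ʳ (λ p a → adjacent t (b , p , a)) (b ≡ᵇ c)) ⟩
    ∑[ b < 2 ] ((∑[ p < suc r ] ∑[ a < suc s ] 𝟙 (adjacent t (b , p , a))) * 𝟙 (b ≡ᵇ c))
      ≡⟨ ∑-select (λ b → ∑[ p < suc r ] ∑[ a < suc s ] 𝟙 (adjacent t (b , p , a))) c ⟩
    ∑[ p < suc r ] ∑[ a < suc s ] 𝟙 (adjacent t (c , p , a))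
      ≡⟨ neighbours-in-layer t c ⟩
    (if colour v ≡ᵇ c then s else r) ∎
    where
    t : Vertex
    t = decode v

  exact-layer : ∀ c → ExactDegrees s r graph (layer c)
  degree-∈ (exact-layer c) v v∈layer =
    trans (degree-layer c v) (cong (if_then s else r) (∈-tabulate⁻ (λ w → colour w ≡ᵇ c) v∈layer))
  degree-∉ (exact-layer c) v v∉layer with colour v ≡ᵇ c in colour≡c | degree-layer c v
  ... | true  | _   = ⊥-elim (v∉layer (∈-tabulate⁺ (λ w → colour w ≡ᵇ c) colour≡c))
  ... | false | deg = deg

  portal : Fin order
  portal = encode (zero , zero , zero)

  colour-portal : colour portal ≡ zero
  colour-portal = cong proj₁ (decode-encode (zero , zero , zero))

  portal∈layer₀ : portal ∈ layer zero
  portal∈layer₀ = ∈-tabulate⁺ (λ w → colour w ≡ᵇ zero) (cong (_≡ᵇ zero) colour-portal)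

  portal∉layer₁ : portal ∉ layer (suc zero)
  portal∉layer₁ portal∈layer₁
    with () ← trans (sym (cong (_≡ᵇ suc zero) colour-portal))
                    (∈-tabulate⁻ (λ w → colour w ≡ᵇ suc zero) portal∈layer₁)

lemma7p2 : (σ ρ : NatSet) → FinOrCofinite σ → FinOrCofinite ρ →
    (s r : ℕ) → σ s → ρ r →
    Σ Graph λ G → ∃ λ u → Provider σ ρ G ⁅ u ⁆ (Lang-σs-ρr s r G ⁅ u ⁆)
lemma7p2 σ ρ _ _ s r σs ρr =
  graph , portal ,
  exact⇒provider {σ} {ρ} σs ρr (exact-layer zero) (exact-layer (suc zero)) portal∈layer₀ portal∉layer₁
  where open Gadget r s
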